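{- For every term $f$ there is a clean derivation in $\mathcal{IL}$ whose code is a term equal to $f$.
   Context: Formulae are built from an infinite set of propositional letters and a constant $I$ using binary connectives $\otimes$ and $\to$. An $\alpha$-formula is a formula considered up to strict associativity of $\otimes$ and strict unitality of $I$ ($A\otimes(B\otimes C)=(A\otimes B)\otimes C$, $A\otimes I=I\otimes A=A$, also inside subformulae). System $\mathcal{IL}$: sequents $G\vdash A$ with $G,A$ $\alpha$-formulae. Axioms $A\vdash A$. Rules (letters denote $\alpha$-formulae, possibly $I$): interchange: from $G\otimes A\otimes B\otimes E\vdash D$ infer $G\otimes B\otimes A\otimes E\vdash D$; cut: from $C\vdash A$ and $G\otimes A\otimes E\vdash D$ infer $G\otimes C\otimes E\vdash D$; $(\to\vdash)$: from $C\vdash A$ and $B\otimes G\vdash D$ infer $C\otimes(A\to B)\otimes G\vdash D$; $(\vdash\to)$: from $A\otimes G\vdash C$ infer $G\vdash A\to C$; $(\otimes\vdash\otimes)$: from $A\vdash C$ and $B\vdash E$ infer $A\otimes B\vdash C\otimes E$. A derivation is clean if it is cut-free, contains no application of $(\otimes\vdash\otimes)$ with an upper sequent $I\vdash I$, and contains no application of interchange in which one of the two permuted $\alpha$-formulae $A,B$ is $I$. Terms with types $f\colon A\vdash B$: primitive $\mathbf 1_A\colon A\vdash A$, $c_{B,A}\colon B\otimes A\vdash A\otimes B$, $\eta_{A,B}\colon B\vdash A\to(A\otimes B)$, $\varepsilon_{A,B}\colon A\otimes(A\to B)\vdash B$; closed under $g\circ f$, $f_1\otimes f_2$, and $A\to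 f\colon A\to B_1\vdash A\to B_2$ (for $f\colon B_1\vdash B_2$); strictly $f\otimes(g\otimes h)=(f\otimes g)\otimes h$, $f\otimes\mathbf 1_I=\mathbf 1_I\otimes f=f$. Equality of terms is the smallest congruence (only between terms of the same type) containing: $g\circ\mathbf 1_A=g$, $\mathbf 1_A\circ f=f$; $h\circ(g\circ f)=(h\circ g)\circ f$; $\mathbf 1_A\otimes\mathbf 1_B=\mathbf 1_{A\otimes B}$; $(g_1\otimes g_2)\circ(f_1\otimes f_2)=(g_1\circ f_1)\otimes(g_2\circ f_2)$; $c_{A',B'}\circ(f\otimes g)=(g\otimes f)\circ c_{A,B}$ ($f\colon A\vdash A'$, $g\colon B\vdash B'$); $c_{B,A}\circ c_{A,B}=\mathbf 1_{A\otimes B}$; $c_{A\otimes B,C}=(c_{A,C}\otimes\mathbf 1_B)\circ(\mathbf 1_A\otimes c_{B,C})$; $A\to(g\circ f)=(A\to g)\circ(A\to f)$; $\eta_{A,B'}\circ f=(A\to(\mathbf 1_A\otimes f))\circ\eta_{A,B}$; $A\to\mathbf 1_B=\mathbf 1_{A\to B}$; $\varepsilon_{A,B'}\circ(\mathbf 1_A\otimes(A\to f))=f\circ\varepsilon_{A,B}$; $\varepsilon_{A,A\otimes B}\circ(\mathbf 1_A\otimes\eta_{A,B})=\mathbf 1_{A\otimes B}$; $(A\to\varepsilon_{A,B})\circ\eta_{A,A\to B}=\mathbf 1_{A\to B}$. Coding of derivations: an axiom $A\vdash A$ is coded by $\mathbf 1_A$; interchange applied to a derivation coded by $f$ gives $f\circ(\mathbf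 1_G\otimes c_{B,A}\otimes\mathbf 1_E)$; cut (left premise $f\colon C\vdash A$, right $g$) gives $g\circ(\mathbf 1_G\otimes f\otimes\mathbf 1_E)$; $(\to\vdash)$ with $f\colon C\vdash A$, $g\colon B\otimes G\vdash D$ gives $g\circ(\varepsilon_{A,B}\otimes\mathbf 1_G)\circ(f\otimes\mathbf 1_{A\to B}\otimes\mathbf 1_G)$; $(\vdash\to)$ with $f\colon A\otimes G\vdash C$ gives $(A\to f)\circ\eta_{A,G}$; $(\otimes\vdash\otimes)$ with $f,g$ gives $f\otimes g$. -}

module Defs where

open import Data.Nat using (ℕ)
open import Data.List using (List; []; _∷_; [_]; _++_)
open import Data.List.Properties using (++-assoc; ++-identityʳ)
open import Data.Product using (_×_)
open import Data.Unit using (⊤)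
open import Data.Empty using (⊥)
open import Relation.Nullary using (¬_)
open import Relation.Binary.PropositionalEquality
  using (_≡_; _≢_; refl; sym; cong; subst₂)

-- An α-formula (formula up to strict associativity of ⊗ and strict
-- unitality of I, also inside subformulae) is represented by its normal
-- form: a list of ⊗-factors, each factor being a propositional letter
-- (letters indexed by ℕ) or an implication between α-formulae.
-- I is the empty list and ⊗ is list concatenation.

data Atom : Set where
  var : ℕ → Atom
  _⇒_ : List Atom → List Atom → Atom

Fm : Set
Fm = List Atom

I : Fm
I = []

_⊸_ : Fm → Fm → Fm
A ⊸ B = [ A ⇒ B ]

data Der : Fm → Fm → Set where
  ax    : (A : Fm) → Der A A
  exch  : (G A B E : Fm) {D : Fm} →
          Der (G ++ A ++ B ++ E) D → Der (G ++ B ++ A ++ E) D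
  cut   : (G E : Fm) {C A D : Fm} →
          Der C A → Der (G ++ A ++ E) D → Der (G ++ C ++ E) D
  impL  : (G : Fm) {C A B D : Fm} →
          Der C A → Der (B ++ G) D → Der (C ++ (A ⊸ B) ++ G) D
  impR  : {A G C : Fm} → Der (A ++ G) C → Der G (A ⊸ C)
  tensR : {A B C E : Fm} → Der A C → Der B E → Der (A ++ B) (C ++ E)

Clean : {Γ Δ : Fm} → Der Γ Δ → Set
Clean (ax A) = ⊤
Clean (exch G A B E d) = (A ≢ I) × (B ≢ I) × Clean d
Clean (cut G E d₁ d₂) = ⊥
Clean (impL G d₁ d₂) = Clean d₁ × Clean d₂
Clean (impR d) = Clean d
Clean (tensR {A} {B} {C} {E} d₁ d₂) =
  ¬ (A ≡ I × C ≡ I) × ¬ (B ≡ I × E ≡ I) × Clean d₁ × Clean d₂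

data Tm : Fm → Fm → Set where
  id   : (A : Fm) → Tm A A
  c    : (B A : Fm) → Tm (B ++ A) (A ++ B)
  η    : (A B : Fm) → Tm B (A ⊸ (A ++ B))
  ε    : (A B : Fm) → Tm (A ++ (A ⊸ B)) B
  _∘_  : {A B C : Fm} → Tm B C → Tm A B → Tm A C
  _⊗_  : {A B C D : Fm} → Tm A B → Tm C D → Tm (A ++ C) (B ++ D)
  arr  : (A : Fm) {B₁ B₂ : Fm} → Tm B₁ B₂ → Tm (A ⊸ B₁) (A ⊸ B₂)

infixr 9 _∘_
infixr 7 _⊗_

cast : {A A' B B' : Fm} → A ≡ A' → B ≡ B' → Tm A B → Tm A' B'
cast p q f = subst₂ Tm p q f

-- Because types are α-formulae represented as lists, the
-- strict identifications f⊗(g⊗h) = (f⊗g)⊗h and f⊗1_I = 1_I⊗f = f relate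
-- terms whose types are equal only propositionally; hence the relation is
-- stated heterogeneously in the indices (every generator relates terms of
-- the same α-formula type, so all related terms have equal types).
infix 4 _≈_
data _≈_ : {A B A' B' : Fm} → Tm A B → Tm A' B' → Set where
  ≈-refl  : {A B : Fm} {f : Tm A B} → f ≈ f
  ≈-sym   : {A B A' B' : Fm} {f : Tm A B} {g : Tm A' B'} → f ≈ g → g ≈ f
  ≈-trans : {A B A' B' A'' B'' : Fm} {f : Tm A B} {g : Tm A' B'}
            {h : Tm A'' B''} → f ≈ g → g ≈ h → f ≈ h
  ∘-cong  : {A B C A' B' C' : Fm} {g : Tm B C} {f : Tm A B}
            {g' : Tm B' C'} {f' : Tm A' B'} →
            g ≈ g' → f ≈ f' → g ∘ f ≈ g' ∘ f'
  ⊗-cong  : {A B C D A' B' C' D' : Fm} {f : Tm A B} {g : Tm C D}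
            {f' : Tm A' B'} {g' : Tm C' D'} →
            f ≈ f' → g ≈ g' → f ⊗ g ≈ f' ⊗ g'
  arr-cong : {A B₁ B₂ B₁' B₂' : Fm} {f : Tm B₁ B₂} {f' : Tm B₁' B₂'} →
            f ≈ f' → arr A f ≈ arr A f'
  ⊗-assoc : {A B C D E F : Fm} {f : Tm A B} {g : Tm C D} {h : Tm E F} →
            f ⊗ (g ⊗ h) ≈ (f ⊗ g) ⊗ h
  ⊗-unitʳ : {A B : Fm} {f : Tm A B} → f ⊗ id I ≈ f
  ⊗-unitˡ : {A B : Fm} {f : Tm A B} → id I ⊗ f ≈ f
  idʳ     : {A B : Fm} {g : Tm A B} → g ∘ id A ≈ g
  idˡ     : {A B : Fm} {f : Tm A B} → id B ∘ f ≈ f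
  ∘-assoc : {A B C D : Fm} {h : Tm C D} {g : Tm B C} {f : Tm A B} →
            h ∘ (g ∘ f) ≈ (h ∘ g) ∘ f
  ⊗-id    : {A B : Fm} → id A ⊗ id B ≈ id (A ++ B)
  ⊗-∘     : {A B C A' B' C' : Fm} {g₁ : Tm B C} {g₂ : Tm B' C'}
            {f₁ : Tm A B} {f₂ : Tm A' B'} →
            (g₁ ⊗ g₂) ∘ (f₁ ⊗ f₂) ≈ (g₁ ∘ f₁) ⊗ (g₂ ∘ f₂)
  c-nat   : {A A' B B' : Fm} {f : Tm A A'} {g : Tm B B'} →
            c A' B' ∘ (f ⊗ g) ≈ (g ⊗ f) ∘ c A B
  c-inv   : {A B : Fm} → c B A ∘ c A B ≈ id (A ++ B)
  c-hex   : {A B C : Fm} →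
            c (A ++ B) C ≈
              (c A C ⊗ id B) ∘
                cast (sym (++-assoc A B C)) (sym (++-assoc A C B))
                     (id A ⊗ c B C)
  arr-∘   : {A B₁ B₂ B₃ : Fm} {g : Tm B₂ B₃} {f : Tm B₁ B₂} →
            arr A (g ∘ f) ≈ arr A g ∘ arr A f
  η-nat   : {A B B' : Fm} {f : Tm B B'} →
            η A B' ∘ f ≈ arr A (id A ⊗ f) ∘ η A B
  arr-id  : {A B : Fm} → arr A (id B) ≈ id (A ⊸ B)
  ε-nat   : {A B B' : Fm} {f : Tm B B'} →
            ε A B' ∘ (id A ⊗ arr A f) ≈ f ∘ ε A B
  εη      : {A B : Fm} → ε A (A ++ B) ∘ (id A ⊗ η A B) ≈ id (A ++ B)
  ηε      : {A B : Fm} → arr A (ε A B) ∘ η A (A ⊸ B) ≈ id (A ⊸ B)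

code : {Γ Δ : Fm} → Der Γ Δ → Tm Γ Δ
code (ax A) = id A
code (exch G A B E d) =
  code d ∘ cast (cong (G ++_) (++-assoc B A E))
                (cong (G ++_) (++-assoc A B E))
                (id G ⊗ c B A ⊗ id E)
code (cut G E f g) = code g ∘ (id G ⊗ code f ⊗ id E)
code (impL G {C} {A} {B} f g) =
  code g ∘ (ε A B ⊗ id G) ∘
    cast refl (sym (++-assoc A (A ⊸ B) G)) (code f ⊗ id (A ⊸ B) ⊗ id G)
code (impR {A} {G} d) = arr A (code d) ∘ η A G
code (tensR d₁ d₂) = code d₁ ⊗ code d₂

{-# OPTIONS --safe #-}
-- Every term constructor except composition is the code of a derivation with one or two
-- rules, and composition is coded by a cut; so the theorem is cut elimination that keeps
-- track of codes. A cut of a derivation of Γ ⊢ A is pushed up its left premise until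
-- (⊗⊢⊗) has split A into single factors. A factor X → Y introduced by (⊢→) from
-- e : X ⊗ Γ ⊢ Y is then pushed up the right premise until it meets the (→⊢) that
-- introduces it from f : C ⊢ X; there ε ∘ (f ⊗ 1) ∘ (1 ⊗ Λe) = e ∘ (f ⊗ 1), where
-- Λe = (X → e) ∘ η is the code of (⊢→), replaces it by cuts on the shallower X and Y.
-- Every other step moves the cut past a rule and holds by naturality of the code of that
-- rule. Derivations stay clean because interchanges with I and (⊗⊢⊗) with a premise
-- I ⊢ I are dropped: their codes are identities, since the hexagon forces c_{I,A} = 1
-- and the only clean derivation of I ⊢ I is the axiom.
module Submission where

open import Data.Empty using (⊥; ⊥-elim)
open import Data.List using ([]; _∷_; [_]; _++_)
open import Data.List.Properties
  using (++-assoc; ++-identityʳ; ++-conicalˡ; ++-conicalʳ; ++-cancelˡ; ∷-injective; ++-monoid)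
open import Data.List.Relation.Unary.All using (All; []; _∷_)
open import Data.List.Relation.Unary.All.Properties using (++⁻ˡ; ++⁻ʳ)
open import Data.Nat using (ℕ; zero; suc; _+_; _≤_; s≤s)
open import Data.Nat.Properties using (m+n≤o⇒m≤o; m+n≤o⇒n≤o; ≤-refl)
open import Data.Product using (Σ; _×_; _,_; proj₁)
open import Data.Unit using (⊤; tt)
open import Relation.Nullary using (Dec; yes; no)
open import Relation.Nullary.Decidable using (_×-dec_)
open import Relation.Binary.PropositionalEquality using (_≡_; refl; sym; trans; cong)

open import Defs
open import Algebra.Solver.Monoid (++-monoid Atom) using (solve; _⊜_; _⊕_)

variable
  a : Atom
  A B C D E G P Q X Y A' B' C' D' E' G' P' Q' U U' V V' Γc Θl Θr Ω : Fm

module ≈-Reasoning where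

  infix  1 begin_
  infixr 2 _≈⟨_⟩_ _≈˘⟨_⟩_
  infix  3 _∎

  begin_ : {f : Tm A B} {g : Tm A' B'} → f ≈ g → f ≈ g
  begin p = p

  _≈⟨_⟩_ : (f : Tm A B) {g : Tm A' B'} {h : Tm C D} → f ≈ g → g ≈ h → f ≈ h
  _ ≈⟨ p ⟩ q = ≈-trans p q

  _≈˘⟨_⟩_ : (f : Tm A B) {g : Tm A' B'} {h : Tm C D} → g ≈ f → g ≈ h → f ≈ h
  _ ≈˘⟨ p ⟩ q = ≈-trans (≈-sym p) q

  _∎ : (f : Tm A B) → f ≈ f
  _ ∎ = ≈-refl

open ≈-Reasoning

infixr 5 _▸_

_▸_ : {f : Tm A B} {g : Tm A' B'} {h : Tm C D} → f ≈ g → g ≈ h → f ≈ h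
_▸_ = ≈-trans

∘-congˡ : {g : Tm B C} {f : Tm A B} {f' : Tm A' B} → f ≈ f' → g ∘ f ≈ g ∘ f'
∘-congˡ = ∘-cong ≈-refl

∘-congʳ : {g : Tm B C} {g' : Tm B C'} {f : Tm A B} → g ≈ g' → g ∘ f ≈ g' ∘ f
∘-congʳ p = ∘-cong p ≈-refl

⊗-congˡ : {f : Tm A B} {g : Tm C D} {g' : Tm C' D'} → g ≈ g' → f ⊗ g ≈ f ⊗ g'
⊗-congˡ = ⊗-cong ≈-refl

⊗-congʳ : {f : Tm A B} {f' : Tm A' B'} {g : Tm C D} → f ≈ f' → f ⊗ g ≈ f' ⊗ g
⊗-congʳ p = ⊗-cong p ≈-refl

cast-≈ : {A A' B B' : Fm} (p : A ≡ A') (q : B ≡ B') (f : Tm A B) → cast p q f ≈ f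
cast-≈ refl refl f = ≈-refl

id-≡ : A ≡ A' → id A ≈ id A'
id-≡ refl = ≈-refl

id-++ : id (A ++ B) ≈ id A ⊗ id B
id-++ = ≈-sym ⊗-id

⊗₃-∘ : {f₁ : Tm B C} {f₂ : Tm B' C'} {f₃ : Tm E G}
       {g₁ : Tm A B} {g₂ : Tm A' B'} {g₃ : Tm D E} →
       (f₁ ⊗ f₂ ⊗ f₃) ∘ (g₁ ⊗ g₂ ⊗ g₃) ≈ (f₁ ∘ g₁) ⊗ (f₂ ∘ g₂) ⊗ (f₃ ∘ g₃)
⊗₃-∘ = ⊗-∘ ▸ ⊗-congˡ ⊗-∘

serialize₁₂ : {f : Tm A B} {g : Tm C D} → f ⊗ g ≈ (f ⊗ id D) ∘ (id A ⊗ g)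
serialize₁₂ = ≈-sym (⊗-∘ ▸ ⊗-cong idʳ idˡ)

serialize₂₁ : {f : Tm A B} {g : Tm C D} → f ⊗ g ≈ (id B ⊗ g) ∘ (f ⊗ id C)
serialize₂₁ = ≈-sym (⊗-∘ ▸ ⊗-cong idˡ idʳ)

c-unitˡ : c I A ≈ id A
c-unitˡ {A = A} = begin
  c [] A                                              ≈˘⟨ idˡ ⟩
  id (A ++ []) ∘ c [] A                               ≈˘⟨ ∘-congʳ inverse ⟩
  ((c A [] ⊗ id []) ∘ (c [] A ⊗ id [])) ∘ c [] A      ≈˘⟨ ∘-assoc ⟩
  (c A [] ⊗ id []) ∘ ((c [] A ⊗ id []) ∘ c [] A)      ≈˘⟨ ∘-cong (≈-sym ⊗-unitʳ) hexagon ⟩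
  c A [] ∘ c [] A                                     ≈⟨ c-inv ⟩
  id A                                                ∎
  where
  inverse : (c A [] ⊗ id []) ∘ (c [] A ⊗ id []) ≈ id (A ++ [])
  inverse = ⊗-∘ ▸ ⊗-cong c-inv idˡ ▸ ⊗-id
  hexagon : c [] A ≈ (c [] A ⊗ id []) ∘ c [] A
  hexagon = c-hex ▸ ∘-congˡ (cast-≈ _ _ _ ▸ ⊗-unitˡ)

c-unitʳ : c A I ≈ id A
c-unitʳ {A = A} = begin
  c A []             ≈˘⟨ idˡ ⟩
  id A ∘ c A []      ≈˘⟨ ∘-congʳ c-unitˡ ⟩
  c [] A ∘ c A []    ≈⟨ c-inv ⟩
  id (A ++ [])       ≈⟨ id-≡ (++-identityʳ A) ⟩
  id A               ∎

whisker : (U : Fm) → Tm A B → (V : Fm) → Tm (U ++ A ++ V) (U ++ B ++ V)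
whisker U f V = id U ⊗ f ⊗ id V

whisker-cong : {f : Tm A B} {f' : Tm A' B'} → f ≈ f' → whisker U f V ≈ whisker U f' V
whisker-cong p = ⊗-congˡ (⊗-congʳ p)

whisker-id : whisker U (id A) V ≈ id (U ++ A ++ V)
whisker-id = ⊗-congˡ ⊗-id ▸ ⊗-id

whisker-∘ : {g : Tm B C} {f : Tm A B} → whisker U g V ∘ whisker U f V ≈ whisker U (g ∘ f) V
whisker-∘ = ⊗₃-∘ ▸ ⊗-cong idˡ (⊗-congˡ idˡ)

whisker-++ˡ : {f : Tm A B} → whisker (U ++ U') f V ≈ id U ⊗ whisker U' f V
whisker-++ˡ = ⊗-congʳ id-++ ▸ ≈-sym ⊗-assoc

whisker-++ʳ : {f : Tm A B} → whisker U f (V ++ V') ≈ whisker U f V ⊗ id V'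
whisker-++ʳ = ⊗-congˡ (⊗-congˡ id-++ ▸ ⊗-assoc) ▸ ⊗-assoc

whisker-absorbˡ : {f : Tm A B} → whisker (U ++ V) f G ≈ whisker U (id V ⊗ f) G
whisker-absorbˡ = whisker-++ˡ ▸ ⊗-congˡ ⊗-assoc

whisker-absorbʳ : {f : Tm A B} → whisker U f (V ++ G) ≈ whisker U (f ⊗ id V) G
whisker-absorbʳ = ⊗-congˡ (⊗-congˡ id-++ ▸ ⊗-assoc)

whisker-slot₁ : {f : Tm A B} →
  whisker U f (V ++ P ++ Q ++ E) ≈ whisker U f V ⊗ id P ⊗ id Q ⊗ id E
whisker-slot₁ = whisker-++ʳ ▸ ⊗-congˡ (id-++ ▸ ⊗-congˡ id-++)

whisker-slot₂ : {f : Tm A B} →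
  whisker (G ++ U) f (V ++ Q ++ E) ≈ id G ⊗ whisker U f V ⊗ id Q ⊗ id E
whisker-slot₂ = whisker-++ˡ ▸ ⊗-congˡ (whisker-++ʳ ▸ ⊗-congˡ id-++)

whisker-slot₃ : {f : Tm A B} →
  whisker (G ++ P ++ U) f (V ++ E) ≈ id G ⊗ id P ⊗ whisker U f V ⊗ id E
whisker-slot₃ = whisker-++ˡ ▸ ⊗-congˡ (whisker-++ˡ ▸ ⊗-congˡ whisker-++ʳ)

whisker-slot₄ : {f : Tm A B} →
  whisker (G ++ P ++ Q ++ U) f V ≈ id G ⊗ id P ⊗ id Q ⊗ whisker U f V
whisker-slot₄ = whisker-++ˡ ▸ ⊗-congˡ (whisker-++ˡ ▸ ⊗-congˡ whisker-++ˡ)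

exchange : (G A B E : Fm) → Tm (G ++ B ++ A ++ E) (G ++ A ++ B ++ E)
exchange G A B E =
  cast (cong (G ++_) (++-assoc B A E)) (cong (G ++_) (++-assoc A B E)) (id G ⊗ c B A ⊗ id E)

exchange-unitˡ : exchange G I B E ≈ id (G ++ B ++ E)
exchange-unitˡ = cast-≈ _ _ _ ▸ whisker-cong c-unitʳ ▸ whisker-id

exchange-unitʳ : exchange G A I E ≈ id (G ++ A ++ E)
exchange-unitʳ = cast-≈ _ _ _ ▸ whisker-cong c-unitˡ ▸ whisker-id

exchange-natural : {G' G A' A B' B E' E : Fm}
  (hG : Tm G' G) (hA : Tm A' A) (hB : Tm B' B) (hE : Tm E' E) →
  (hG ⊗ hA ⊗ hB ⊗ hE) ∘ exchange G' A' B' E' ≈ exchange G A B E ∘ (hG ⊗ hB ⊗ hA ⊗ hE)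
exchange-natural {G'} {G} {A'} {A} {B'} {B} {E'} {E} hG hA hB hE = begin
  (hG ⊗ hA ⊗ hB ⊗ hE) ∘ exchange G' A' B' E'
    ≈⟨ ∘-cong (⊗-congˡ ⊗-assoc) (cast-≈ _ _ _) ⟩
  (hG ⊗ (hA ⊗ hB) ⊗ hE) ∘ whisker G' (c B' A') E'
    ≈⟨ ⊗₃-∘ ⟩
  (hG ∘ id G') ⊗ ((hA ⊗ hB) ∘ c B' A') ⊗ (hE ∘ id E')
    ≈⟨ ⊗-cong (idʳ ▸ ≈-sym idˡ) (⊗-cong (≈-sym c-nat) (idʳ ▸ ≈-sym idˡ)) ⟩
  (id G ∘ hG) ⊗ (c B A ∘ (hB ⊗ hA)) ⊗ (id E ∘ hE)
    ≈˘⟨ ⊗₃-∘ ⟩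
  whisker G (c B A) E ∘ (hG ⊗ (hB ⊗ hA) ⊗ hE)
    ≈˘⟨ ∘-cong (cast-≈ _ _ _) (⊗-congˡ ⊗-assoc) ⟩
  exchange G A B E ∘ (hG ⊗ hB ⊗ hA ⊗ hE) ∎

exchange-involutive : exchange G A B E ∘ exchange G B A E ≈ id (G ++ A ++ B ++ E)
exchange-involutive {G = G} {A = A} {B = B} {E = E} = begin
  exchange G A B E ∘ exchange G B A E
    ≈⟨ ∘-cong (cast-≈ _ _ _) (cast-≈ _ _ _) ⟩
  whisker G (c B A) E ∘ whisker G (c A B) E
    ≈⟨ whisker-∘ ⟩
  whisker G (c B A ∘ c A B) E
    ≈⟨ whisker-cong c-inv ▸ whisker-id ⟩
  id (G ++ (A ++ B) ++ E)
    ≈⟨ id-≡ (cong (G ++_) (++-assoc A B E)) ⟩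
  id (G ++ A ++ B ++ E) ∎

exchange-whisker : exchange (U ++ G) A B (E ++ V) ≈ whisker U (exchange G A B E) V
exchange-whisker {U = U} {G = G} {A = A} {B = B} {E = E} {V = V} = begin
  exchange (U ++ G) A B (E ++ V)
    ≈⟨ cast-≈ _ _ _ ⟩
  id (U ++ G) ⊗ c B A ⊗ id (E ++ V)
    ≈⟨ ⊗-cong id-++ (⊗-congˡ id-++) ▸ ≈-sym ⊗-assoc ⟩
  id U ⊗ id G ⊗ c B A ⊗ id E ⊗ id V
    ≈⟨ ⊗-congˡ (⊗-congˡ ⊗-assoc ▸ ⊗-assoc) ⟩
  id U ⊗ (id G ⊗ c B A ⊗ id E) ⊗ id V
    ≈˘⟨ whisker-cong (cast-≈ _ _ _) ⟩
  whisker U (exchange G A B E) V ∎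

ev : Tm C A → Tm (C ++ A ⊸ B) B
ev {A = A} {B = B} f = ε A B ∘ (f ⊗ id (A ⊸ B))

curry : (A : Fm) {G C : Fm} → Tm (A ++ G) C → Tm G (A ⊸ C)
curry A {G} f = arr A f ∘ η A G

code-impL : (d₁ : Der C A) (d₂ : Der (B ++ G) D) →
            code (impL G d₁ d₂) ≈ code d₂ ∘ (ev (code d₁) ⊗ id G)
code-impL d₁ d₂ = ∘-congˡ (∘-congˡ (cast-≈ _ _ _ ▸ ⊗-assoc) ▸ ⊗-∘ ▸ ⊗-congˡ idˡ)

ev-id : ev (id A) ≈ ε A B
ev-id = ∘-congˡ ⊗-id ▸ idʳ

ev-curry : {f : Tm C A} {e : Tm (A ++ G) B} → ev f ∘ (id C ⊗ curry A e) ≈ e ∘ (f ⊗ id G)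
ev-curry {C = C} {A = A} {G = G} {B = B} {f = f} {e = e} = begin
  (ε A B ∘ (f ⊗ id (A ⊸ B))) ∘ (id C ⊗ curry A e)
    ≈˘⟨ ∘-assoc ⟩
  ε A B ∘ (f ⊗ id (A ⊸ B)) ∘ (id C ⊗ curry A e)
    ≈⟨ ∘-congˡ (≈-sym serialize₁₂ ▸ serialize₂₁) ⟩
  ε A B ∘ (id A ⊗ arr A e ∘ η A G) ∘ (f ⊗ id G)
    ≈˘⟨ ∘-congˡ (∘-congʳ (⊗-∘ ▸ ⊗-congʳ idˡ)) ⟩
  ε A B ∘ ((id A ⊗ arr A e) ∘ (id A ⊗ η A G)) ∘ (f ⊗ id G)
    ≈⟨ ∘-assoc ▸ ∘-congʳ ∘-assoc ⟩
  ((ε A B ∘ (id A ⊗ arr A e)) ∘ (id A ⊗ η A G)) ∘ (f ⊗ id G)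
    ≈⟨ ∘-congʳ (∘-congʳ ε-nat) ⟩
  ((e ∘ ε A (A ++ G)) ∘ (id A ⊗ η A G)) ∘ (f ⊗ id G)
    ≈⟨ ∘-congʳ (≈-sym ∘-assoc ▸ ∘-congˡ εη ▸ idʳ) ⟩
  e ∘ (f ⊗ id G) ∎

curry-ev : {f : Tm B C} → curry A (f ∘ ev (id A)) ≈ arr A f
curry-ev {B = B} {A = A} {f = f} = begin
  arr A (f ∘ ev (id A)) ∘ η A (A ⊸ B)
    ≈⟨ ∘-congʳ (arr-cong (∘-congˡ ev-id) ▸ arr-∘) ⟩
  (arr A f ∘ arr A (ε A B)) ∘ η A (A ⊸ B)
    ≈˘⟨ ∘-assoc ⟩
  arr A f ∘ arr A (ε A B) ∘ η A (A ⊸ B)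
    ≈⟨ ∘-congˡ ηε ▸ idʳ ⟩
  arr A f ∎

ev-∘ : {f : Tm C A} {h : Tm C' C} → ev {B = B} (f ∘ h) ≈ ev f ∘ (h ⊗ id (A ⊸ B))
ev-∘ = ∘-congˡ (⊗-congˡ (≈-sym idˡ) ▸ ≈-sym ⊗-∘) ▸ ∘-assoc

curry-∘ : {e : Tm (A ++ G) C} {h : Tm G' G} → curry A (e ∘ (id A ⊗ h)) ≈ curry A e ∘ h
curry-∘ = ∘-congʳ arr-∘ ▸ ≈-sym ∘-assoc ▸ ∘-congˡ (≈-sym η-nat) ▸ ∘-assoc

ev-curry-⊗ : {f : Tm C A} {e : Tm (A ++ G) B} {g : Tm (B ++ E) D} →
  (g ∘ (ev f ⊗ id E)) ∘ ((id C ⊗ curry A e) ⊗ id E) ≈ g ∘ ((e ∘ (f ⊗ id G)) ⊗ id E)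
ev-curry-⊗ = ≈-sym ∘-assoc ▸ ∘-congˡ (⊗-∘ ▸ ⊗-cong ev-curry idˡ)

-- f need not have type Γ ⊢ D on the nose: the heterogeneous ≈ absorbs rebracketings of ++.
CleanlyCoded : (Γ D : Fm) → Tm A B → Set
CleanlyCoded Γ D f = Σ (Der Γ D) (λ d → Clean d × code d ≈ f)

recode : {f : Tm A B} {g : Tm A' B'} → f ≈ g → CleanlyCoded C D f → CleanlyCoded C D g
recode q (d , cl , p) = d , cl , p ▸ q

reindex : {f : Tm A B} → C ≡ C' → D ≡ D' → CleanlyCoded C D f → CleanlyCoded C' D' f
reindex refl refl r = r

retype : (p : C ≡ C') {f : Tm C D} → CleanlyCoded C D f → CleanlyCoded C' D (cast p refl f)
retype refl r = r

_≟I : (A : Fm) → Dec (A ≡ I)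
[] ≟I = yes refl
(_ ∷ _) ≟I = no λ ()

code-clean-I⊢I : (d : Der C D) → Clean d → C ≡ I → D ≡ I → code d ≈ id I
code-clean-I⊢I (ax A) _ A≡I _ = id-≡ A≡I
code-clean-I⊢I (exch G A B E d) (A≢I , _) G++B++A++E≡I _ =
  ⊥-elim (A≢I (++-conicalˡ A E (++-conicalʳ B _ (++-conicalʳ G _ G++B++A++E≡I))))
code-clean-I⊢I (impL G {C} d₁ d₂) _ Γ≡I _ with ++-conicalʳ C _ Γ≡I
... | ()
code-clean-I⊢I (tensR {A} {B} {C} {E} d₁ d₂) (not-I⊢I , _) A++B≡I C++E≡I =
  ⊥-elim (not-I⊢I (++-conicalˡ A B A++B≡I , ++-conicalˡ C E C++E≡I))

axᶜ : (A : Fm) → CleanlyCoded A A (id A)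
axᶜ A = ax A , tt , ≈-refl

exchᶜ : (G A B E : Fm) {f : Tm (G ++ A ++ B ++ E) D} →
        CleanlyCoded (G ++ A ++ B ++ E) D f → CleanlyCoded (G ++ B ++ A ++ E) D (f ∘ exchange G A B E)
exchᶜ G [] B E (d , cl , p) = d , cl , p ▸ ≈-sym (∘-congˡ exchange-unitˡ ▸ idʳ)
exchᶜ G (_ ∷ _) [] E (d , cl , p) = d , cl , p ▸ ≈-sym (∘-congˡ exchange-unitʳ ▸ idʳ)
exchᶜ G A@(_ ∷ _) B@(_ ∷ _) E (d , cl , p) = exch G A B E d , ((λ ()) , (λ ()) , cl) , ∘-congʳ p

impLᶜ : (G : Fm) {f : Tm C A} {g : Tm (B ++ G) D} →
        CleanlyCoded C A f → CleanlyCoded (B ++ G) D g →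
        CleanlyCoded (C ++ A ⊸ B ++ G) D (g ∘ (ev f ⊗ id G))
impLᶜ G (d₁ , cl₁ , p₁) (d₂ , cl₂ , p₂) =
  impL G d₁ d₂ , (cl₁ , cl₂) ,
  code-impL d₁ d₂ ▸ ∘-cong p₂ (⊗-congʳ (∘-congˡ (⊗-congʳ p₁)))

impRᶜ : {f : Tm (A ++ G) C} → CleanlyCoded (A ++ G) C f → CleanlyCoded G (A ⊸ C) (curry A f)
impRᶜ (d , cl , p) = impR d , cl , ∘-congʳ (arr-cong p)

tensRᶜ : {f : Tm A' C'} {g : Tm B' E'} →
         CleanlyCoded A C f → CleanlyCoded B E g → CleanlyCoded (A ++ B) (C ++ E) (f ⊗ g)
tensRᶜ {A = A} {C = C} {B = B} {E = E} r₁@(d₁ , cl₁ , p₁) r₂@(d₂ , cl₂ , p₂)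
  with A ≟I ×-dec C ≟I | B ≟I ×-dec E ≟I
... | yes (refl , refl) | _ =
  recode (≈-sym ⊗-unitˡ ▸ ⊗-congʳ (≈-sym (code-clean-I⊢I d₁ cl₁ refl refl) ▸ p₁)) r₂
... | no _ | yes (refl , refl) =
  reindex (sym (++-identityʳ A)) (sym (++-identityʳ C))
    (recode (≈-sym ⊗-unitʳ ▸ ⊗-congˡ (≈-sym (code-clean-I⊢I d₂ cl₂ refl refl) ▸ p₂)) r₁)
... | no not-I⊢I₁ | no not-I⊢I₂ =
  tensR d₁ d₂ , (not-I⊢I₁ , not-I⊢I₂ , cl₁ , cl₂) , ⊗-cong p₁ p₂

exchᶜ-natural : (hG : Tm G' G) (hP : Tm P' P) (hQ : Tm Q' Q) (hE : Tm E' E)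
  {R : Tm (G ++ P ++ Q ++ E) D} →
  CleanlyCoded (G' ++ P' ++ Q' ++ E') D (R ∘ (hG ⊗ hP ⊗ hQ ⊗ hE)) →
  CleanlyCoded (G' ++ Q' ++ P' ++ E') D ((R ∘ exchange G P Q E) ∘ (hG ⊗ hQ ⊗ hP ⊗ hE))
exchᶜ-natural hG hP hQ hE r =
  recode (≈-sym ∘-assoc ▸ ∘-congˡ (exchange-natural hG hP hQ hE) ▸ ∘-assoc) (exchᶜ _ _ _ _ r)

impLᶜ-inContext : {C A B D : Fm} (U G : Fm) {f : Tm C A} {g : Tm (U ++ B ++ G) D} →
  CleanlyCoded C A f → CleanlyCoded (U ++ B ++ G) D g →
  CleanlyCoded (U ++ C ++ A ⊸ B ++ G) D (g ∘ whisker U (ev f) G)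
impLᶜ-inContext {C} {A} {B} U G {f} {g} r₁ r₂ =
  reindex (cong (U ++_) (++-assoc C (A ⊸ B) G)) refl
    (recode code≈ (exchᶜ [] (C ++ A ⊸ B) U G (reindex (sym (++-assoc C (A ⊸ B) (U ++ G))) refl
      (impLᶜ (U ++ G) r₁ (exchᶜ [] U B G r₂)))))
  where
  code≈ : ((g ∘ exchange [] U B G) ∘ (ev f ⊗ id (U ++ G))) ∘ exchange [] (C ++ A ⊸ B) U G
           ≈ g ∘ whisker U (ev f) G
  code≈ = begin
    ((g ∘ exchange [] U B G) ∘ (ev f ⊗ id (U ++ G))) ∘ exchange [] (C ++ A ⊸ B) U G
      ≈⟨ ∘-congʳ (∘-congˡ (≈-sym ⊗-unitˡ ▸ ⊗-congˡ (⊗-congˡ id-++))) ▸ ≈-sym ∘-assoc ⟩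
    (g ∘ exchange [] U B G) ∘ (id [] ⊗ ev f ⊗ id U ⊗ id G) ∘ exchange [] (C ++ A ⊸ B) U G
      ≈⟨ ∘-congˡ (exchange-natural (id []) (ev f) (id U) (id G)) ⟩
    (g ∘ exchange [] U B G) ∘ exchange [] B U G ∘ (id [] ⊗ id U ⊗ ev f ⊗ id G)
      ≈⟨ ≈-sym ∘-assoc ▸ ∘-congˡ (∘-assoc ▸ ∘-congʳ exchange-involutive ▸ idˡ) ⟩
    g ∘ (id [] ⊗ id U ⊗ ev f ⊗ id G)
      ≈⟨ ∘-congˡ ⊗-unitˡ ⟩
    g ∘ whisker U (ev f) G ∎

Depth≤ : ℕ → Atom → Set
Depth≤ _ (var _) = ⊤
Depth≤ zero (_ ⇒ _) = ⊥
Depth≤ (suc n) (X ⇒ Y) = All (Depth≤ n) X × All (Depth≤ n) Y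

mutual
  atomSize : Atom → ℕ
  atomSize (var _) = 0
  atomSize (X ⇒ Y) = suc (size X + size Y)

  size : Fm → ℕ
  size [] = 0
  size (a ∷ A) = atomSize a + size A

mutual
  atomSize⇒depth≤ : (n : ℕ) (a : Atom) → atomSize a ≤ n → Depth≤ n a
  atomSize⇒depth≤ _ (var _) _ = tt
  atomSize⇒depth≤ (suc n) (X ⇒ Y) (s≤s le) =
    size⇒depth≤ n X (m+n≤o⇒m≤o (size X) le) , size⇒depth≤ n Y (m+n≤o⇒n≤o (size X) le)

  size⇒depth≤ : (n : ℕ) (A : Fm) → size A ≤ n → All (Depth≤ n) A
  size⇒depth≤ _ [] _ = []
  size⇒depth≤ n (a ∷ A) le =
    atomSize⇒depth≤ n a (m+n≤o⇒m≤o (atomSize a) le) ∷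
    size⇒depth≤ n A (m+n≤o⇒n≤o (atomSize a) le)

++-assoc₃ : (A B C D : Fm) → (A ++ B ++ C) ++ D ≡ A ++ B ++ C ++ D
++-assoc₃ = solve 4 (λ a b c d → (a ⊕ b ⊕ c) ⊕ d ⊜ a ⊕ b ⊕ c ⊕ d) refl

data Split (X Y Θl : Fm) (a : Atom) (Θr : Fm) : Set where
  inˡ : (M : Fm) → X ≡ Θl ++ a ∷ M → Θr ≡ M ++ Y → Split X Y Θl a Θr
  inʳ : (M : Fm) → Y ≡ M ++ a ∷ Θr → Θl ≡ X ++ M → Split X Y Θl a Θr

split : (X Y Θl Θr : Fm) {a : Atom} → X ++ Y ≡ Θl ++ a ∷ Θr → Split X Y Θl a Θr
split [] Y Θl Θr eq = inʳ Θl eq refl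
split (x ∷ X) Y [] Θr eq with ∷-injective eq
... | refl , eq' = inˡ X refl (sym eq')
split (x ∷ X) Y (_ ∷ Θl) Θr eq with ∷-injective eq
... | refl , eq' with split X Y Θl Θr eq'
...   | inˡ M p q = inˡ M (cong (x ∷_) p) q
...   | inʳ M p q = inʳ M p (cong (x ∷_) q)

Cuttable : Tm C A → Set
Cuttable {C = C} {A = A} f = (Θl Θr : Fm) {D : Fm} {g : Tm (Θl ++ A ++ Θr) D} →
  CleanlyCoded (Θl ++ A ++ Θr) D g → CleanlyCoded (Θl ++ C ++ Θr) D (g ∘ whisker Θl f Θr)

cuttable-resp : {f f' : Tm C A} → f ≈ f' → Cuttable f → Cuttable f'
cuttable-resp q cut-f Θl Θr r = recode (∘-congˡ (whisker-cong q)) (cut-f Θl Θr r)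

cuttable-id : Cuttable (id A)
cuttable-id Θl Θr r = recode (≈-sym (∘-congˡ whisker-id ▸ idʳ)) r

cuttable-exch : {f : Tm (G ++ P ++ Q ++ E) A} → Cuttable f → Cuttable (f ∘ exchange G P Q E)
cuttable-exch {G = G} {P = P} {Q = Q} {E = E} cut-f Θl Θr r =
  reindex conclusion refl
    (recode code≈ (exchᶜ (Θl ++ G) P Q (E ++ Θr) (retype premise (cut-f Θl Θr r))))
  where
  premise = solve 6 (λ θl g p q e θr → θl ⊕ (g ⊕ p ⊕ q ⊕ e) ⊕ θr ⊜ (θl ⊕ g) ⊕ p ⊕ q ⊕ e ⊕ θr)
                    refl Θl G P Q E Θr
  conclusion = solve 6 (λ θl g p q e θr → (θl ⊕ g) ⊕ q ⊕ p ⊕ e ⊕ θr ⊜ θl ⊕ (g ⊕ q ⊕ p ⊕ e) ⊕ θr)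
                       refl Θl G P Q E Θr
  code≈ = ∘-cong (cast-≈ _ _ _) exchange-whisker ▸ ≈-sym ∘-assoc ▸ ∘-congˡ whisker-∘

cuttable-impL : {f : Der C A'} {g : Der (B' ++ G) A} →
                Clean f → Cuttable (code g) → Cuttable (code (impL G f g))
cuttable-impL {C = C} {A' = A'} {B' = B'} {G = G} {f = f} {g = g} clf cut-g Θl Θr r =
  reindex conclusion refl
    (recode code≈ (impLᶜ-inContext Θl (G ++ Θr) (f , clf , ≈-refl) (retype premise (cut-g Θl Θr r))))
  where
  premise = cong (Θl ++_) (++-assoc B' G Θr)
  conclusion = cong (Θl ++_) (sym (++-assoc C (A' ⊸ B' ++ G) Θr))
  code≈ = ∘-cong (cast-≈ _ _ _) whisker-absorbʳ ▸ ≈-sym ∘-assoc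
          ▸ ∘-congˡ (whisker-∘ ▸ whisker-cong (≈-sym (code-impL f g)))

cuttable-⊗ : {f₁ : Tm C A} {f₂ : Tm C' A'} → Cuttable f₁ → Cuttable f₂ → Cuttable (f₁ ⊗ f₂)
cuttable-⊗ {C = C} {A = A} {C' = C'} {A' = A'} {f₁ = f₁} {f₂ = f₂} cut₁ cut₂ Θl Θr {g = g} r =
  reindex conclusion refl
    (recode code≈ (cut₂ (Θl ++ C) Θr (retype premise₂ (cut₁ Θl (A' ++ Θr) (retype premise₁ r)))))
  where
  premise₁ = cong (Θl ++_) (++-assoc A A' Θr)
  premise₂ = sym (++-assoc Θl C (A' ++ Θr))
  conclusion = trans (++-assoc Θl C (C' ++ Θr)) (cong (Θl ++_) (sym (++-assoc C C' Θr)))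
  code≈ = begin
    cast premise₂ refl (cast premise₁ refl g ∘ whisker Θl f₁ (A' ++ Θr)) ∘ whisker (Θl ++ C) f₂ Θr
      ≈⟨ ∘-cong (cast-≈ _ _ _ ▸ ∘-cong (cast-≈ _ _ _) whisker-absorbʳ) whisker-absorbˡ ⟩
    (g ∘ whisker Θl (f₁ ⊗ id A') Θr) ∘ whisker Θl (id C ⊗ f₂) Θr
      ≈⟨ ≈-sym ∘-assoc ▸ ∘-congˡ whisker-∘ ⟩
    g ∘ whisker Θl ((f₁ ⊗ id A') ∘ (id C ⊗ f₂)) Θr
      ≈˘⟨ ∘-congˡ (whisker-cong serialize₁₂) ⟩
    g ∘ whisker Θl (f₁ ⊗ f₂) Θr ∎

CutInto : Tm Γc [ a ] → (Θl Θr : Fm) → Der Ω D → Ω ≡ Θl ++ a ∷ Θr → Set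
CutInto {Γc = Γc} {D = D} L Θl Θr d pos =
  CleanlyCoded (Θl ++ Γc ++ Θr) D (code d ∘ cast refl (sym pos) (whisker Θl L Θr))

CutsInto : Tm Γc [ a ] → Der Ω D → Set
CutsInto {a = a} {Ω = Ω} L d = (Θl Θr : Fm) (pos : Ω ≡ Θl ++ a ∷ Θr) → CutInto L Θl Θr d pos

cuttable-atom : {L : Tm Γc [ a ]} →
                ({Ω D : Fm} (d : Der Ω D) → Clean d → CutsInto L d) → Cuttable L
cuttable-atom cuts Θl Θr (d , cl , p) = recode (∘-congʳ p) (cuts d cl Θl Θr refl)

cutsInto-ax : {L : Tm Γc [ a ]} → CleanlyCoded Γc [ a ] L → CutsInto L (ax A)
cutsInto-ax r Θl Θr refl = recode (≈-sym idˡ) (tensRᶜ (axᶜ Θl) (tensRᶜ r (axᶜ Θr)))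

cutInto-exch : {L : Tm Γc [ a ]} {G P Q E G' P' Q' E' Θl' Θr' : Fm} {d : Der (G ++ P ++ Q ++ E) D}
  {pos' : G ++ P ++ Q ++ E ≡ Θl' ++ a ∷ Θr'} {pos : G ++ Q ++ P ++ E ≡ Θl ++ a ∷ Θr}
  (hG : Tm G' G) (hP : Tm P' P) (hQ : Tm Q' Q) (hE : Tm E' E) →
  whisker Θl' L Θr' ≈ hG ⊗ hP ⊗ hQ ⊗ hE → whisker Θl L Θr ≈ hG ⊗ hQ ⊗ hP ⊗ hE →
  Θl' ++ Γc ++ Θr' ≡ G' ++ P' ++ Q' ++ E' → G' ++ Q' ++ P' ++ E' ≡ Θl ++ Γc ++ Θr →
  CutInto L Θl' Θr' d pos' → CutInto L Θl Θr (exch G P Q E d) pos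
cutInto-exch hG hP hQ hE premise-slots conclusion-slots premise conclusion r =
  reindex conclusion refl (recode (∘-congˡ (≈-sym conclusion-slots ▸ ≈-sym (cast-≈ _ _ _)))
    (exchᶜ-natural hG hP hQ hE
      (reindex premise refl (recode (∘-congˡ (cast-≈ _ _ _ ▸ premise-slots)) r))))

cutsInto-exch : {L : Tm Γc [ a ]} {d : Der (G ++ P ++ Q ++ E) D} →
                CutsInto L d → CutsInto L (exch G P Q E d)
cutsInto-exch {Γc = Γc} {a = a} {G = G} {P = P} {Q = Q} {E = E} {L = L} cuts Θl Θr pos
  with split G (Q ++ P ++ E) Θl Θr pos
... | inˡ M refl refl =
  cutInto-exch (whisker Θl L M) (id P) (id Q) (id E) whisker-slot₁ whisker-slot₁
    (sym (++-assoc₃ Θl Γc M (P ++ Q ++ E))) (++-assoc₃ Θl Γc M (Q ++ P ++ E))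
    (cuts Θl (M ++ P ++ Q ++ E) (++-assoc Θl (a ∷ M) (P ++ Q ++ E)))
... | inʳ M e refl with split Q (P ++ E) M Θr e
...   | inˡ M' refl refl =
  cutInto-exch (id G) (id P) (whisker M L M') (id E) whisker-slot₃ whisker-slot₂ premise conclusion
    (cuts (G ++ P ++ M) (M' ++ E) position)
  where
  premise = solve 6 (λ g p m γ m' e → (g ⊕ p ⊕ m) ⊕ γ ⊕ m' ⊕ e ⊜ g ⊕ p ⊕ (m ⊕ γ ⊕ m') ⊕ e)
                    refl G P M Γc M' E
  conclusion = solve 6 (λ g p m γ m' e → g ⊕ (m ⊕ γ ⊕ m') ⊕ p ⊕ e ⊜ (g ⊕ m) ⊕ γ ⊕ m' ⊕ p ⊕ e)
                       refl G P M Γc M' E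
  position = solve 6 (λ g p m x m' e → g ⊕ p ⊕ (m ⊕ x ⊕ m') ⊕ e ⊜ (g ⊕ p ⊕ m) ⊕ x ⊕ m' ⊕ e)
                     refl G P M [ a ] M' E
...   | inʳ M' e' refl with split P E M' Θr e'
...     | inˡ M'' refl refl =
  cutInto-exch (id G) (whisker M' L M'') (id Q) (id E) whisker-slot₂ whisker-slot₃ premise conclusion
    (cuts (G ++ M') (M'' ++ Q ++ E) position)
  where
  premise = solve 6 (λ g m' γ m'' q e → (g ⊕ m') ⊕ γ ⊕ m'' ⊕ q ⊕ e ⊜ g ⊕ (m' ⊕ γ ⊕ m'') ⊕ q ⊕ e)
                    refl G M' Γc M'' Q E
  conclusion = solve 6 (λ g m' γ m'' q e → g ⊕ q ⊕ (m' ⊕ γ ⊕ m'') ⊕ e ⊜ (g ⊕ q ⊕ m') ⊕ γ ⊕ m'' ⊕ e)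
                       refl G M' Γc M'' Q E
  position = solve 6 (λ g m' x m'' q e → g ⊕ (m' ⊕ x ⊕ m'') ⊕ q ⊕ e ⊜ (g ⊕ m') ⊕ x ⊕ m'' ⊕ q ⊕ e)
                     refl G M' [ a ] M'' Q E
...     | inʳ M'' refl refl =
  cutInto-exch (id G) (id P) (id Q) (whisker M'' L Θr) whisker-slot₄ whisker-slot₄ premise conclusion
    (cuts (G ++ P ++ Q ++ M'') Θr position)
  where
  premise = solve 6 (λ g p q m'' γ θr → (g ⊕ p ⊕ q ⊕ m'') ⊕ γ ⊕ θr ⊜ g ⊕ p ⊕ q ⊕ m'' ⊕ γ ⊕ θr)
                    refl G P Q M'' Γc Θr
  conclusion = solve 6 (λ g p q m'' γ θr → g ⊕ q ⊕ p ⊕ m'' ⊕ γ ⊕ θr ⊜ (g ⊕ q ⊕ p ⊕ m'') ⊕ γ ⊕ θr)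
                       refl G P Q M'' Γc Θr
  position = solve 6 (λ g p q m'' x θr → g ⊕ p ⊕ q ⊕ m'' ⊕ x ⊕ θr ⊜ (g ⊕ p ⊕ q ⊕ m'') ⊕ x ⊕ θr)
                     refl G P Q M'' [ a ] Θr

cutsInto-impR : {L : Tm Γc [ a ]} {e : Der (A ++ Ω) C} → CutsInto L e → CutsInto L (impR {A} {Ω} e)
cutsInto-impR {Γc = Γc} {a = a} {A = A} cuts Θl Θr refl =
  recode curry-∘
    (impRᶜ (reindex (++-assoc A Θl (Γc ++ Θr)) refl
      (recode (∘-congˡ (cast-≈ _ _ _ ▸ whisker-++ˡ)) (cuts (A ++ Θl) Θr (sym (++-assoc A Θl (a ∷ Θr)))))))

cutsInto-tensR : {L : Tm Γc [ a ]} {d₁ : Der P C} {d₂ : Der Q E} → Clean d₁ → Clean d₂ →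
  CutsInto L d₁ → CutsInto L d₂ → CutsInto L (tensR d₁ d₂)
cutsInto-tensR {Γc = Γc} {P = P} {Q = Q} {d₁ = d₁} {d₂ = d₂} cl₁ cl₂ cuts₁ cuts₂ Θl Θr pos
  with split P Q Θl Θr pos
... | inˡ M refl refl =
  reindex (++-assoc₃ Θl Γc M Q) refl
    (recode (≈-sym (∘-congˡ (cast-≈ _ _ _ ▸ whisker-++ʳ) ▸ ⊗-∘ ▸ ⊗-congˡ idʳ))
      (tensRᶜ (cuts₁ Θl M refl) (d₂ , cl₂ , ≈-refl)))
... | inʳ M refl refl =
  reindex (sym (++-assoc P M (Γc ++ Θr))) refl
    (recode (≈-sym (∘-congˡ (cast-≈ _ _ _ ▸ whisker-++ˡ) ▸ ⊗-∘ ▸ ⊗-congʳ idʳ))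
      (tensRᶜ (d₁ , cl₁ , ≈-refl) (cuts₂ M Θr refl)))

-- Only the caller knows that L comes from (⊢→) and has bounded depth, so the principal
-- case is an argument of cutsInto-impL.
Principal : Tm Γc [ a ] → Der C A → Der (B ++ G) D → Set
Principal {a = a} {C = C} {A = A} {B = B} {G = G} L f g =
  (pos : C ++ A ⊸ B ++ G ≡ C ++ a ∷ G) → CutInto L C G (impL G {B = B} f g) pos

cutsInto-impL : {L : Tm Γc [ a ]} {f : Der C A} {g : Der (B ++ G) D} → Clean f → Clean g →
  CutsInto L f → CutsInto L g → Principal L f g → CutsInto L (impL G {B = B} f g)
cutsInto-impL {Γc = Γc} {C = C} {A = A} {B = B} {G = G} {L = L} {f = f} {g = g}
              clf clg cuts-f cuts-g principal Θl Θr pos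
  with split C ((A ⇒ B) ∷ G) Θl Θr pos
... | inˡ M refl refl =
  reindex (++-assoc₃ Θl Γc M (A ⊸ B ++ G)) refl
    (recode code≈ (impLᶜ G (cuts-f Θl M refl) (g , clg , ≈-refl)))
  where
  code≈ = begin
    code g ∘ (ev (code f ∘ whisker Θl L M) ⊗ id G)
      ≈⟨ ∘-congˡ (⊗-congʳ ev-∘) ⟩
    code g ∘ ((ev (code f) ∘ (whisker Θl L M ⊗ id (A ⊸ B))) ⊗ id G)
      ≈˘⟨ ∘-congˡ (⊗-∘ ▸ ⊗-congˡ idˡ) ⟩
    code g ∘ (ev (code f) ⊗ id G) ∘ ((whisker Θl L M ⊗ id (A ⊸ B)) ⊗ id G)
      ≈⟨ ∘-assoc ⟩
    (code g ∘ (ev (code f) ⊗ id G)) ∘ ((whisker Θl L M ⊗ id (A ⊸ B)) ⊗ id G)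
      ≈˘⟨ ∘-cong (code-impL f g) (cast-≈ _ _ _ ▸ whisker-++ʳ ▸ ⊗-congˡ id-++ ▸ ⊗-assoc) ⟩
    code (impL G f g) ∘ cast refl (sym pos) (whisker Θl L (M ++ (A ⇒ B) ∷ G)) ∎
... | inʳ [] e refl with ∷-injective e
...   | A⇒B≡a , refl =
  reindex (cong (_++ Γc ++ G) (sym (++-identityʳ C))) refl
    (recode (∘-congˡ (cast-≈ _ _ _ ▸ ⊗-congʳ (id-≡ (sym (++-identityʳ C))) ▸ ≈-sym (cast-≈ _ _ _)))
      (principal (cong (λ x → C ++ x ∷ G) A⇒B≡a)))
cutsInto-impL {Γc = Γc} {a = a} {C = C} {A = A} {B = B} {L = L} {f = f} {g = g}
              clf clg cuts-f cuts-g principal Θl Θr pos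
  | inʳ (_ ∷ M) e refl with ∷-injective e
...   | refl , refl =
  reindex (sym (++-assoc C ((A ⇒ B) ∷ M) (Γc ++ Θr))) refl
    (recode code≈ (impLᶜ (M ++ Γc ++ Θr) (f , clf , ≈-refl)
      (reindex (++-assoc B M (Γc ++ Θr)) refl
        (recode (∘-congˡ (cast-≈ _ _ _ ▸ whisker-++ˡ)) (cuts-g (B ++ M) Θr (sym (++-assoc B M (a ∷ Θr))))))))
  where
  h = whisker M L Θr
  code≈ = begin
    (code g ∘ (id B ⊗ h)) ∘ (ev (code f) ⊗ id (M ++ Γc ++ Θr))
      ≈˘⟨ ∘-assoc ⟩
    code g ∘ (id B ⊗ h) ∘ (ev (code f) ⊗ id (M ++ Γc ++ Θr))
      ≈⟨ ∘-congˡ (≈-sym serialize₂₁ ▸ serialize₁₂) ⟩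
    code g ∘ (ev (code f) ⊗ id (M ++ a ∷ Θr)) ∘ (id (C ++ A ⊸ B) ⊗ h)
      ≈⟨ ∘-assoc ⟩
    (code g ∘ (ev (code f) ⊗ id (M ++ a ∷ Θr))) ∘ (id (C ++ A ⊸ B) ⊗ h)
      ≈˘⟨ ∘-cong (code-impL f g)
                 (cast-≈ _ _ _ ▸ whisker-++ˡ {U = C} ▸ ⊗-congˡ (whisker-++ˡ {U = A ⊸ B}) ▸ ⊗-assoc ▸ ⊗-congʳ ⊗-id) ⟩
    code (impL (M ++ a ∷ Θr) f g) ∘ cast refl (sym pos) (whisker (C ++ (A ⇒ B) ∷ M) L Θr) ∎

-- Induction on the depth bound n, then on the left premise (cutᴸ) until the cut formula is
-- an implication introduced by (⊢→), then on the right premise (cutᴿ); only the principal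
-- case lowers n.
mutual
  cutᴸ : (n : ℕ) (d : Der C A) → Clean d → All (Depth≤ n) A → Cuttable (code d)
  cutᴸ n (ax A) _ _ = cuttable-id
  cutᴸ n (exch G P Q E d) (_ , _ , cl) b = cuttable-exch (cutᴸ n d cl b)
  cutᴸ n (impL G f g) (clf , clg) b = cuttable-impL clf (cutᴸ n g clg b)
  cutᴸ n (impR e) cl (b ∷ []) = cuttable-atom (cutᴿ n e cl b)
  cutᴸ n (tensR {C = C} d₁ d₂) (_ , _ , cl₁ , cl₂) b =
    cuttable-⊗ (cutᴸ n d₁ cl₁ (++⁻ˡ C b)) (cutᴸ n d₂ cl₂ (++⁻ʳ C b))

  cutᴿ : (n : ℕ) (e : Der (X ++ Γc) Y) → Clean e → Depth≤ n (X ⇒ Y) →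
         (d : Der Ω D) → Clean d → CutsInto (curry X (code e)) d
  cutᴿ n e cle b (ax _) _ = cutsInto-ax (impR e , cle , ≈-refl)
  cutᴿ n e cle b (exch G P Q E d) (_ , _ , cl) = cutsInto-exch (cutᴿ n e cle b d cl)
  cutᴿ n e cle b (impL G {B = B} f g) (clf , clg) =
    cutsInto-impL {B = B} clf clg (cutᴿ n e cle b f clf) (cutᴿ n e cle b g clg)
      (cut-principal {B = B} n e cle b f clf g clg)
  cutᴿ n e cle b (impR d) cl = cutsInto-impR (cutᴿ n e cle b d cl)
  cutᴿ n e cle b (tensR d₁ d₂) (_ , _ , cl₁ , cl₂) =
    cutsInto-tensR cl₁ cl₂ (cutᴿ n e cle b d₁ cl₁) (cutᴿ n e cle b d₂ cl₂)

  cut-principal : {X Y Γc C A B G D : Fm} (n : ℕ) (e : Der (X ++ Γc) Y) → Clean e →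
                  Depth≤ n (X ⇒ Y) → (f : Der C A) → Clean f → (g : Der (B ++ G) D) → Clean g →
                  Principal (curry X (code e)) f g
  cut-principal {Γc = Γc} {C} {G = G} (suc m) e cle (bX , bY) f clf g clg pos
    with proj₁ (∷-injective (++-cancelˡ C _ _ pos))
  ... | refl =
    reindex (++-assoc C Γc G) refl
      (recode code≈ (cutᶜ m bY (cutᶜ m bX (f , clf , ≈-refl) [] Γc (e , cle , ≈-refl))
                                [] G (g , clg , ≈-refl)))
    where
    code≈ = ∘-congˡ (⊗-unitˡ ▸ ⊗-congʳ (∘-congˡ ⊗-unitˡ)) ▸ ≈-sym ev-curry-⊗
        ▸ ∘-cong (≈-sym (code-impL f g)) (≈-sym (cast-≈ _ _ _ ▸ ⊗-assoc))

  cutᶜ : (n : ℕ) {f : Tm C A} → All (Depth≤ n) A → CleanlyCoded C A f → Cuttable f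
  cutᶜ n b (d , cl , p) = cuttable-resp p (cutᴸ n d cl b)

cut-admissible : {f : Tm C A} → CleanlyCoded C A f → Cuttable f
cut-admissible {A = A} = cutᶜ (size A) (size⇒depth≤ (size A) A ≤-refl)

cᶜ : (B A : Fm) → CleanlyCoded (B ++ A) (A ++ B) (c B A)
cᶜ B A = reindex (cong (B ++_) (++-identityʳ A)) (cong (A ++_) (++-identityʳ B))
  (recode (idˡ ▸ cast-≈ _ _ _ ▸ ⊗-unitˡ ▸ ⊗-unitʳ) (exchᶜ [] A B [] (axᶜ (A ++ B ++ []))))

ηᶜ : (A B : Fm) → CleanlyCoded B (A ⊸ (A ++ B)) (η A B)
ηᶜ A B = recode (∘-congʳ arr-id ▸ idˡ) (impRᶜ (axᶜ (A ++ B)))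

εᶜ : (A B : Fm) → CleanlyCoded (A ++ A ⊸ B) B (ε A B)
εᶜ A B = reindex refl (++-identityʳ B) (recode (idˡ ▸ ⊗-unitʳ ▸ ev-id) (impLᶜ [] (axᶜ A) (axᶜ (B ++ []))))

_∘ᶜ_ : {g : Tm B C} {f : Tm A B} → CleanlyCoded B C g → CleanlyCoded A B f → CleanlyCoded A C (g ∘ f)
_∘ᶜ_ {B = B} {A = A} rg rf =
  reindex (++-identityʳ A) refl
    (recode (∘-cong (cast-≈ _ _ _) (⊗-unitˡ ▸ ⊗-unitʳ))
      (cut-admissible rf [] [] (retype (sym (++-identityʳ B)) rg)))

arrᶜ : (A : Fm) {f : Tm B C} → CleanlyCoded B C f → CleanlyCoded (A ⊸ B) (A ⊸ C) (arr A f)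
arrᶜ {B = B} A r =
  recode curry-ev
    (impRᶜ (recode (∘-cong (cast-≈ _ _ _) ⊗-unitʳ) (impLᶜ [] (axᶜ A) (retype (sym (++-identityʳ B)) r))))

proposition4p19 : {A B : Fm} (f : Tm A B) →
    Σ (Der A B) (λ d → Clean d × (code d ≈ f))
proposition4p19 (id A) = axᶜ A
proposition4p19 (c B A) = cᶜ B A
proposition4p19 (η A B) = ηᶜ A B
proposition4p19 (ε A B) = εᶜ A B
proposition4p19 (g ∘ f) = proposition4p19 g ∘ᶜ proposition4p19 f
proposition4p19 (f ⊗ g) = tensRᶜ (proposition4p19 f) (proposition4p19 g)
proposition4p19 (arr A f) = arrᶜ A (proposition4p19 f)
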